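{- Let $G$ be a connected finite graph of order $n\geqslant 3$, and let $m\geqslant 3$ and $k\geqslant 1$ be integers. Then (i) $D(G^{\frac{1}{k}})\leqslant D\big((G^{\frac{1}{k}})^m\big)$; (ii) $D\big((G^m)^{\frac{1}{k}}\big)\leqslant D(G^m)$.
   Context: Graphs are finite and simple. The $m$-th power $H^m$ of a graph $H$ is the graph on $V(H)$ in which distinct $x,y$ are adjacent iff $1\leqslant d_H(x,y)\leqslant m$. The $k$-subdivision $H^{\frac{1}{k}}$ is obtained by replacing each edge $uv$ of $H$ by a path of length $k$ between $u$ and $v$ with $k-1$ new internal vertices. The distinguishing number $D(H)$ is the least $d$ such that some labeling $V(H)\to\{1,\dots,d\}$ is preserved by no non-trivial automorphism of $H$. -}

module Defs where

open import Data.Nat using (ℕ; zero; suc; _≤_)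
open import Data.Fin using (Fin; toℕ; _<_)
open import Data.Sum using (_⊎_; inj₁; inj₂)
open import Data.Product using (Σ; _×_; ∃; _,_)
open import Relation.Nullary using (¬_)
open import Relation.Binary.PropositionalEquality using (_≡_; _≢_)
open import Function.Bundles using (_↔_; Inverse)

record Graph (V : Set) : Set₁ where
  constructor mkGraph
  field
    adj : V → V → Set
open Graph public

IsSimple : {V : Set} → Graph V → Set
IsSimple {V} G = (∀ (x y : V) → adj G x y → adj G y x) × (∀ (x : V) → ¬ adj G x x)

data Walk {V : Set} (G : Graph V) : V → V → ℕ → Set where
  nil  : ∀ {x} → Walk G x x 0
  cons : ∀ {x y z ℓ} → adj G x y → Walk G y z ℓ → Walk G x z (suc ℓ)

Connected : {V : Set} → Graph V → Set
Connected {V} G = ∀ (x y : V) → ∃ λ ℓ → Walk G x y ℓ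

IsDist : {V : Set} → Graph V → V → V → ℕ → Set
IsDist G x y d = Walk G x y d × (∀ ℓ → Walk G x y ℓ → d ≤ ℓ)

Power : {V : Set} → Graph V → ℕ → Graph V
Power G m = mkGraph λ x y → (x ≢ y) × Σ ℕ (λ d → IsDist G x y d × (1 ≤ d) × (d ≤ m))

-- Edges of a graph on Fin n, as pairs src < tgt; the adjacency proof is
-- irrelevant, so each edge {u,v} is represented exactly once.
record Edge {n : ℕ} (G : Graph (Fin n)) : Set where
  constructor edge
  field
    src tgt : Fin n
    src<tgt : src < tgt
    .isAdj  : adj G src tgt

-- Vertices of the k-subdivision: original vertices, plus k-1 internal
-- vertices for each edge.
SubV : {n : ℕ} → Graph (Fin n) → ℕ → Set
SubV {n} G k = Fin n ⊎ (Edge G × Fin (Data.Nat._∸_ k 1))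

-- OnPath G k e j x : x is the j-th vertex (0 ≤ j ≤ k) of the path
-- u = p₀, p₁, …, p_k = v replacing the edge e = uv.
data OnPath {n : ℕ} (G : Graph (Fin n)) (k : ℕ) (e : Edge G) : ℕ → SubV G k → Set where
  start : OnPath G k e 0 (inj₁ (Edge.src e))
  end   : OnPath G k e k (inj₁ (Edge.tgt e))
  mid   : (i : Fin (Data.Nat._∸_ k 1)) → OnPath G k e (suc (toℕ i)) (inj₂ (e , i))

Subdiv : {n : ℕ} → (G : Graph (Fin n)) → (k : ℕ) → Graph (SubV G k)
Subdiv G k = mkGraph λ x y → Σ (Edge G) λ e → Σ ℕ λ j →
  (OnPath G k e j x × OnPath G k e (suc j) y) ⊎ (OnPath G k e j y × OnPath G k e (suc j) x)

record Aut {V : Set} (G : Graph V) : Set where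
  field
    perm     : V ↔ V
    preserve : ∀ x y → adj G x y → adj G (Inverse.to perm x) (Inverse.to perm y)
    reflect  : ∀ x y → adj G (Inverse.to perm x) (Inverse.to perm y) → adj G x y

IsDistinguishing : {V : Set} (G : Graph V) {d : ℕ} → (V → Fin d) → Set
IsDistinguishing {V} G c = (σ : Aut G) →
  (∀ x → c (Inverse.to (Aut.perm σ) x) ≡ c x) → ∀ x → Inverse.to (Aut.perm σ) x ≡ x

HasDistinguishing : {V : Set} → Graph V → ℕ → Set
HasDistinguishing {V} G d = Σ (V → Fin d) λ c → IsDistinguishing G c

IsDistNum : {V : Set} → Graph V → ℕ → Set
IsDistNum G d = HasDistinguishing G d × (∀ d' → HasDistinguishing G d' → d ≤ d')

module Submission where

-- G is a connected simple graph on n ≥ 3 vertices, m ≥ 3, k ≥ 1, H = G^m.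
-- (i) Automorphisms preserve distances, so every automorphism of a graph K is one
--     of K^m; a distinguishing labeling of K^m thus distinguishes K: D(K) ≤ D(K^m).
-- (ii) Extend a distinguishing labeling c of H to H^{1/k} by c(0) on subdivision
--     vertices, and let τ be an automorphism of H^{1/k} preserving the labels.
--     τ maps some original vertex to an original one: a vertex labeled unlike 0 if
--     c is not constant; otherwise n ≥ 4 (H = K₃ needs three labels) and vertex 0,
--     having three H-neighbours, cannot go to a degree-2 subdivision vertex.  Since
--     τ carries the path replacing an edge onto the path of an edge, this spreads
--     over the connected graph H; then τ restricts to a label-preserving
--     automorphism of H, the identity, and a τ fixing the original vertices is the
--     identity.  Adjacency in G^m quantifies over all walks and is not
--     decidable constructively, so facts about G^m are proved under double
--     negation; this suffices since the conclusion τ(x) ≡ x is decidable.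

open import Defs
open import Data.Bool using (Bool; true; false)
open import Data.Empty using (⊥-elim)
import Data.Empty.Irrelevant as Irrelevant
open import Data.Fin using (Fin; toℕ; fromℕ<) renaming (zero to fzero; suc to fsuc; _<_ to _<ᶠ_)
import Data.Fin.Properties as Finₚ
open import Data.Fin.Permutation using (transpose; _⟨$⟩ʳ_)
open import Data.List using (List; []; _∷_; length; lookup)
open import Data.List.Membership.Propositional using (_∈_; _∉_)
open import Data.List.Membership.Propositional.Properties using (∈-lookup)
import Data.List.Membership.DecPropositional as DecMembership
open import Data.List.Relation.Unary.All using (All; []; _∷_)
import Data.List.Relation.Unary.All as All
open import Data.List.Relation.Unary.AllPairs using ([]; _∷_)
open import Data.List.Relation.Unary.Any using (here; there; index)
open import Data.List.Relation.Unary.Any.Properties using (lookup-index)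
open import Data.List.Relation.Unary.Unique.Propositional using (Unique)
open import Data.Nat using (ℕ; zero; suc; _≤_; _<_; _∸_; z≤n; s≤s; z<s; _<?_)
open import Data.Nat.Induction using (<-rec)
open import Data.Nat.Properties
open import Data.Product using (Σ; _×_; _,_; proj₁; proj₂)
open import Data.Sum using (_⊎_; inj₁; inj₂; [_,_]′)
import Data.Sum.Properties as Sumₚ
import Data.Product.Properties as Productₚ
open import Effect.Monad using (RawMonad)
open import Function using (_∘_; Inverse; mk↔ₛ′; Injective; Injection)
open import Function.Properties.Inverse using (↔⇒↣)
open import Level using (0ℓ)
open import Relation.Binary.Definitions using (tri<; tri≈; tri>)
open import Relation.Binary.PropositionalEquality hiding ([_])
open import Relation.Nullary using (¬_; Dec; yes; no; ¬?)
open import Relation.Nullary.Decidable using (decidable-stable; ¬¬-excluded-middle)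
open import Relation.Nullary.Negation using (¬¬-Monad; DoubleNegation)

open RawMonad (¬¬-Monad {0ℓ})


module _ {V : Set} {G : Graph V} where

  snoc : ∀ {x y z ℓ} → Walk G x y ℓ → adj G y z → Walk G x z (suc ℓ)
  snoc nil a = cons a nil
  snoc (cons b w) a = cons b (snoc w a)

  reverse : (∀ x y → adj G x y → adj G y x) → ∀ {x y ℓ} → Walk G x y ℓ → Walk G y x ℓ
  reverse symmetric nil = nil
  reverse symmetric (cons {x} {y} a w) = snoc (reverse symmetric w) (symmetric x y a)

  positive-length : ∀ {x y ℓ} → x ≢ y → Walk G x y ℓ → 1 ≤ ℓ
  positive-length x≢x nil = ⊥-elim (x≢x refl)
  positive-length _ (cons _ _) = s≤s z≤n

map-walk : ∀ {V W : Set} {G : Graph V} {K : Graph W} (f : V → W) →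
  (∀ x y → adj G x y → adj K (f x) (f y)) → ∀ {x y ℓ} → Walk G x y ℓ → Walk K (f x) (f y) ℓ
map-walk f f-adj nil = nil
map-walk f f-adj (cons {x} {y} a w) = cons (f-adj x y a) (map-walk f f-adj w)

leaving-edge : ∀ {n} {G : Graph (Fin n)} (F : List (Fin n)) {u x ℓ} → Walk G u x ℓ → u ∈ F → x ∉ F →
  Σ (Fin n) λ z → z ∉ F × Σ (Fin n) λ w → w ∈ F × adj G w z
leaving-edge F nil u∈F u∉F = ⊥-elim (u∉F u∈F)
leaving-edge F {u} (cons {y = y} a w) u∈F x∉F with DecMembership._∈?_ Finₚ._≟_ y F
... | yes y∈F = leaving-edge F w y∈F x∉F
... | no y∉F = y , y∉F , u , u∈F , a


module _ {V : Set} {G : Graph V} (σ : Aut G) where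

  ⟦_⟧ ⟦_⟧⁻ : V → V
  ⟦_⟧ = Inverse.to (Aut.perm σ)
  ⟦_⟧⁻ = Inverse.from (Aut.perm σ)

  ⟦⟧-⟦⟧⁻ : ∀ x → ⟦ ⟦ x ⟧⁻ ⟧ ≡ x
  ⟦⟧-⟦⟧⁻ = Inverse.strictlyInverseˡ (Aut.perm σ)

  ⟦⟧⁻-⟦⟧ : ∀ x → ⟦ ⟦ x ⟧ ⟧⁻ ≡ x
  ⟦⟧⁻-⟦⟧ = Inverse.strictlyInverseʳ (Aut.perm σ)

  ⟦⟧-injective : ∀ {x y} → ⟦ x ⟧ ≡ ⟦ y ⟧ → x ≡ y
  ⟦⟧-injective = Injection.injective (↔⇒↣ (Aut.perm σ))

  aut⁻¹ : Aut G
  aut⁻¹ = record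
    { perm = mk↔ₛ′ ⟦_⟧⁻ ⟦_⟧ ⟦⟧⁻-⟦⟧ ⟦⟧-⟦⟧⁻
    ; preserve = λ x y a → Aut.reflect σ ⟦ x ⟧⁻ ⟦ y ⟧⁻ (subst₂ (adj G) (sym (⟦⟧-⟦⟧⁻ x)) (sym (⟦⟧-⟦⟧⁻ y)) a)
    ; reflect = λ x y a → subst₂ (adj G) (⟦⟧-⟦⟧⁻ x) (⟦⟧-⟦⟧⁻ y) (Aut.preserve σ ⟦ x ⟧⁻ ⟦ y ⟧⁻ a) }

distNum-≤ : ∀ {V W : Set} {K : Graph V} {K' : Graph W} →
  (∀ d → HasDistinguishing K' d → HasDistinguishing K d) →
  ∀ d₁ d₂ → IsDistNum K d₁ → IsDistNum K' d₂ → d₁ ≤ d₂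
distNum-≤ transfer d₁ d₂ (_ , least) (distinguishing₂ , _) = least d₂ (transfer d₂ distinguishing₂)

-- In a complete graph a distinguishing labeling separates the vertices 0 and 1:
-- otherwise the transposition (0 1) is a non-trivial automorphism preserving it.
complete-separates : ∀ {n d} (H : Graph (Fin (suc (suc n)))) → (∀ x → ¬ adj H x x) →
  (∀ x y → x ≢ y → adj H x y) → (c : Fin (suc (suc n)) → Fin d) → IsDistinguishing H c →
  c fzero ≢ c (fsuc fzero)
complete-separates H irreflexive complete c distinguishing c₀≡c₁ =
  1≢0 (distinguishing swap swap-labels fzero)
  where
    1≢0 : fsuc {suc _} fzero ≢ fzero
    1≢0 ()

    t = transpose fzero (fsuc fzero)

    distinct : ∀ {x y} → adj H x y → x ≢ y
    distinct {x} a refl = irreflexive x a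

    swap : Aut H
    swap = record
      { perm = t
      ; preserve = λ x y a → complete _ _ (distinct a ∘ Injection.injective (↔⇒↣ t))
      ; reflect = λ x y a → complete _ _ (distinct a ∘ cong (t ⟨$⟩ʳ_)) }

    swap-labels : ∀ x → c (t ⟨$⟩ʳ x) ≡ c x
    swap-labels fzero = sym c₀≡c₁
    swap-labels (fsuc fzero) = c₀≡c₁
    swap-labels (fsuc (fsuc x)) = refl


module _ {V : Set} {G : Graph V} (m : ℕ) where

  -- Automorphisms preserve distances, hence adjacency in the m-th power.
  power-preserve : (σ : Aut G) → ∀ x y → adj (Power G m) x y → adj (Power G m) (⟦ σ ⟧ x) (⟦ σ ⟧ y)
  power-preserve σ x y (x≢y , d , (w , least) , 1≤d , d≤m) =
    x≢y ∘ ⟦⟧-injective σ , d , (map-walk ⟦ σ ⟧ (Aut.preserve σ) w , least′) , 1≤d , d≤m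
    where
      least′ : ∀ ℓ → Walk G (⟦ σ ⟧ x) (⟦ σ ⟧ y) ℓ → d ≤ ℓ
      least′ ℓ w′ = least ℓ (subst₂ (λ a b → Walk G a b ℓ) (⟦⟧⁻-⟦⟧ σ x) (⟦⟧⁻-⟦⟧ σ y)
                               (map-walk ⟦ σ ⟧⁻ (Aut.preserve (aut⁻¹ σ)) w′))

  power-aut : Aut G → Aut (Power G m)
  power-aut σ = record
    { perm = Aut.perm σ
    ; preserve = power-preserve σ
    ; reflect = λ x y a → subst₂ (adj (Power G m)) (⟦⟧⁻-⟦⟧ σ x) (⟦⟧⁻-⟦⟧ σ y) (power-preserve (aut⁻¹ σ) _ _ a) }

distNum-≤-power : ∀ {V : Set} (K : Graph V) (m : ℕ) →
  ∀ d₁ d₂ → IsDistNum K d₁ → IsDistNum (Power K m) d₂ → d₁ ≤ d₂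
distNum-≤-power K m = distNum-≤ λ _ (c , distinguishing) → c , distinguishing ∘ power-aut m


¬¬-Π-Fin : ∀ n {P : Fin n → Set} → (∀ i → DoubleNegation (P i)) → DoubleNegation (∀ i → P i)
¬¬-Π-Fin zero _ = pure λ ()
¬¬-Π-Fin (suc n) {P} p = do
  p₀ ← p fzero
  ps ← ¬¬-Π-Fin n (p ∘ fsuc)
  pure λ where fzero → p₀ ; (fsuc i) → ps i

¬¬-decidable : ∀ {n} (R : Fin n → Fin n → Set) → DoubleNegation (∀ x y → Dec (R x y))
¬¬-decidable {n} R = ¬¬-Π-Fin n λ x → ¬¬-Π-Fin n λ y → ¬¬-excluded-middle

Least : (ℕ → Set) → ℕ → Set
Least P d = P d × (∀ ℓ → P ℓ → d ≤ ℓ)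

least-element : (P : ℕ → Set) {ℓ : ℕ} → P ℓ → DoubleNegation (Σ ℕ (Least P))
least-element P {ℓ} = <-rec (λ ℓ → P ℓ → DoubleNegation (Σ ℕ (Least P))) step ℓ
  where
    step : ∀ ℓ → (∀ {ℓ'} → ℓ' < ℓ → P ℓ' → DoubleNegation (Σ ℕ (Least P))) →
           P ℓ → DoubleNegation (Σ ℕ (Least P))
    step ℓ below p = do
      yes (ℓ' , ℓ'<ℓ , p') ← ¬¬-excluded-middle {A = Σ ℕ λ ℓ' → ℓ' < ℓ × P ℓ'}
        where no none → pure (ℓ , p , λ ℓ' p' → ≮⇒≥ λ ℓ'<ℓ → none (ℓ' , ℓ'<ℓ , p'))
      below ℓ'<ℓ p'


fresh : ∀ {n} (L : List (Fin n)) → length L < n → Σ (Fin n) λ x → x ∉ L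
fresh {n} L L<n = Finₚ.¬∀⟶∃¬ n (_∈ L) (λ x → DecMembership._∈?_ Finₚ._≟_ x L)
  λ covers → <⇒≱ L<n (Finₚ.injective⇒≤ (index-injective covers))
  where
    index-injective : (covers : ∀ x → x ∈ L) → Injective _≡_ _≡_ (index ∘ covers)
    index-injective covers {x} {y} eq =
      trans (lookup-index (covers x)) (trans (cong (lookup L) eq) (sym (lookup-index (covers y))))

distinct-length : ∀ {n} (L : List (Fin n)) → Unique L → length L ≤ n
distinct-length L unique = Finₚ.injective⇒≤ (lookup-injective unique)
  where
    lookup-injective : ∀ {L : List (Fin _)} → Unique L → Injective _≡_ _≡_ (lookup L)
    lookup-injective (_ ∷ _) {fzero} {fzero} _ = refl
    lookup-injective (x∉ ∷ _) {fzero} {fsuc j} eq = ⊥-elim (All.lookup x∉ (∈-lookup j) eq)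
    lookup-injective (x∉ ∷ _) {fsuc i} {fzero} eq = ⊥-elim (All.lookup x∉ (∈-lookup i) (sym eq))
    lookup-injective (_ ∷ unique) {fsuc i} {fsuc j} eq = cong fsuc (lookup-injective unique eq)

two-of-three : ∀ {A : Set} {p q t₁ t₂ t₃ : A} → t₁ ≡ p ⊎ t₁ ≡ q → t₂ ≡ p ⊎ t₂ ≡ q → t₃ ≡ p ⊎ t₃ ≡ q →
  t₁ ≡ t₂ ⊎ t₁ ≡ t₃ ⊎ t₂ ≡ t₃
two-of-three (inj₁ a) (inj₁ b) _ = inj₁ (trans a (sym b))
two-of-three (inj₂ a) (inj₂ b) _ = inj₁ (trans a (sym b))
two-of-three (inj₁ a) (inj₂ b) (inj₁ c) = inj₂ (inj₁ (trans a (sym c)))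
two-of-three (inj₁ a) (inj₂ b) (inj₂ c) = inj₂ (inj₂ (trans b (sym c)))
two-of-three (inj₂ a) (inj₁ b) (inj₁ c) = inj₂ (inj₂ (trans b (sym c)))
two-of-three (inj₂ a) (inj₁ b) (inj₂ c) = inj₂ (inj₁ (trans a (sym c)))

ThreeNeighbours : {V : Set} → Graph V → V → Set
ThreeNeighbours {V} H u = Σ V λ v₁ → Σ V λ v₂ → Σ V λ v₃ →
  (v₁ ≢ v₂ × v₁ ≢ v₃ × v₂ ≢ v₃) × (adj H u v₁ × adj H u v₂ × adj H u v₃)

∸-suc : ∀ {m j} → j < m → m ∸ j ≡ suc (m ∸ suc j)
∸-suc j<m = +-∸-assoc 1 j<m


module _ {V : Set} {G : Graph V} where

  power-simple : ∀ m → IsSimple G → IsSimple (Power G m)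
  power-simple m (symmetric , _) = power-symmetric , λ x a → proj₁ a refl
    where
      power-symmetric : ∀ x y → adj (Power G m) x y → adj (Power G m) y x
      power-symmetric x y (x≢y , d , (w , least) , bounds) =
        x≢y ∘ sym , d , (reverse symmetric w , λ ℓ w′ → least ℓ (reverse symmetric w′)) , bounds

  power-adj : ∀ {m} → 1 ≤ m → IsSimple G → ∀ {x y} → adj G x y → adj (Power G m) x y
  power-adj 1≤m (_ , irreflexive) {x} {y} a =
    x≢y , 1 , (cons a nil , λ ℓ w → positive-length x≢y w) , ≤-refl , 1≤m
    where
      x≢y : x ≢ y
      x≢y refl = irreflexive x a

  power-connected : ∀ {m} → 1 ≤ m → IsSimple G → Connected G → Connected (Power G m)
  power-connected 1≤m simple connected x y with ℓ , w ← connected x y =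
    ℓ , map-walk (λ v → v) (λ _ _ → power-adj 1≤m simple) w

module ConnectedPower {n : ℕ} (G : Graph (Fin n)) (simple : IsSimple G) (connected : Connected G)
                      (m : ℕ) (3≤m : 3 ≤ m) where

  H : Graph (Fin n)
  H = Power G m

  Near : Fin n → ℕ → Fin n → Set
  Near u j z = Σ ℕ λ ℓ → ℓ ≤ j × Walk G u z ℓ

  near-refl : ∀ {u j} → Near u j u
  near-refl = 0 , z≤n , nil

  near-mono : ∀ {u j j' z} → j ≤ j' → Near u j z → Near u j' z
  near-mono j≤j' (ℓ , ℓ≤j , w) = ℓ , ≤-trans ℓ≤j j≤j' , w

  -- A vertex z ≠ u within distance m of u is adjacent to u in G^m: classically,
  -- the distance d(u,z) exists.
  near-adjacent : ∀ {u z} → Near u m z → u ≢ z → DoubleNegation (adj H u z)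
  near-adjacent {u} {z} (ℓ , ℓ≤m , w) u≢z = do
    d , shortest , least ← least-element (Walk G u z) w
    pure (u≢z , d , (shortest , least) , positive-length u≢z shortest , ≤-trans (least ℓ w) ℓ≤m)

  grow : ∀ {u j x} (F : List (Fin n)) → All (Near u j) F → u ∈ F → x ∉ F →
    Σ (Fin n) λ z → z ∉ F × Near u (suc j) z
  grow {u} {x = x} F near u∈F x∉F
    with z , z∉F , w , w∈F , a ← leaving-edge F (proj₂ (connected u x)) u∈F x∉F
    with ℓ , ℓ≤j , walk ← All.lookup near w∈F
    = z , z∉F , suc ℓ , s≤s ℓ≤j , snoc walk a

  private
    ∉⇒≢ : ∀ {y z} {F : List (Fin n)} → z ∉ F → y ∈ F → y ≢ z
    ∉⇒≢ z∉F y∈F refl = z∉F y∈F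

  -- With n ≥ 4, growing the ball around u three times produces three distinct
  -- vertices within distance 3 ≤ m, i.e. three distinct neighbours in G^m.
  three-neighbours : 3 < n → ∀ u → DoubleNegation (ThreeNeighbours H u)
  three-neighbours 3<n u
    with z₁ , z₁∉ , near₁ ← grow (u ∷ []) (near-refl ∷ []) (here refl)
                              (proj₂ (fresh (u ∷ []) (≤-trans (s≤s (s≤s z≤n)) 3<n)))
    with z₂ , z₂∉ , near₂ ← grow (u ∷ z₁ ∷ []) (near-refl ∷ near₁ ∷ []) (here refl)
                              (proj₂ (fresh (u ∷ z₁ ∷ []) (≤-trans (s≤s (s≤s (s≤s z≤n))) 3<n)))
    with z₃ , z₃∉ , near₃ ← grow (u ∷ z₁ ∷ z₂ ∷ []) (near-refl ∷ near-mono (n≤1+n 1) near₁ ∷ near₂ ∷ [])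
                              (here refl) (proj₂ (fresh (u ∷ z₁ ∷ z₂ ∷ []) 3<n))
    = do
      a₁ ← near-adjacent (near-mono (≤-trans (s≤s z≤n) 3≤m) near₁) (∉⇒≢ z₁∉ (here refl))
      a₂ ← near-adjacent (near-mono (≤-trans (s≤s (s≤s z≤n)) 3≤m) near₂) (∉⇒≢ z₂∉ (here refl))
      a₃ ← near-adjacent (near-mono 3≤m near₃) (∉⇒≢ z₃∉ (here refl))
      pure (z₁ , z₂ , z₃ ,
            (∉⇒≢ z₂∉ (there (here refl)) , ∉⇒≢ z₃∉ (there (here refl)) , ∉⇒≢ z₃∉ (there (there (here refl)))) ,
            a₁ , a₂ , a₃)

  -- With n = 3, G^m is complete: growing the ball around x twice reaches y, as
  -- Fin 3 has no four distinct elements.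
  adjacent-when-three : n < 4 → ∀ {x y} → x ≢ y → DoubleNegation (adj H x y)
  adjacent-when-three n<4 {x} {y} x≢y
    with z₁ , z₁∉ , near₁ ← grow {j = 0} {y} (x ∷ []) (near-refl ∷ []) (here refl) (λ where (here refl) → x≢y refl)
    with z₁ Finₚ.≟ y
  ... | yes refl = near-adjacent (near-mono (≤-trans (s≤s z≤n) 3≤m) near₁) x≢y
  ... | no z₁≢y
    with z₂ , z₂∉ , near₂ ← grow {j = 1} {y} (x ∷ z₁ ∷ []) (near-refl ∷ near₁ ∷ []) (here refl)
                              (λ where (here refl) → x≢y refl ; (there (here refl)) → z₁≢y refl)
    with z₂ Finₚ.≟ y
  ... | yes refl = near-adjacent (near-mono (≤-trans (s≤s (s≤s z≤n)) 3≤m) near₂) x≢y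
  ... | no z₂≢y = ⊥-elim (<⇒≱ n<4 (distinct-length (x ∷ z₁ ∷ z₂ ∷ y ∷ []) distinct))
    where
      distinct : Unique (x ∷ z₁ ∷ z₂ ∷ y ∷ [])
      distinct = (∉⇒≢ z₁∉ (here refl) ∷ ∉⇒≢ z₂∉ (here refl) ∷ x≢y ∷ [])
               ∷ (∉⇒≢ z₂∉ (there (here refl)) ∷ z₁≢y ∷ [])
               ∷ (z₂≢y ∷ [])
               ∷ [] ∷ []

  complete-when-three : n < 4 → DoubleNegation (∀ x y → x ≢ y → adj H x y)
  complete-when-three n<4 = ¬¬-Π-Fin n λ x → ¬¬-Π-Fin n λ y → adjacent-if-distinct x y
    where
      adjacent-if-distinct : ∀ x y → DoubleNegation (x ≢ y → adj H x y)
      adjacent-if-distinct x y with x Finₚ.≟ y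
      ... | yes refl = pure λ x≢x → ⊥-elim (x≢x refl)
      ... | no x≢y = do
        a ← adjacent-when-three n<4 x≢y
        pure λ _ → a

module Subdivision {n : ℕ} (H : Graph (Fin n)) (simple : IsSimple H) (k' : ℕ) where
  open Edge

  k : ℕ
  k = suc k'

  Vertex : Set
  Vertex = SubV H k

  S : Graph Vertex
  S = Subdiv H k

  IsOriginal : Vertex → Set
  IsOriginal x = Σ (Fin n) λ w → x ≡ inj₁ w

  edge-≡ : {e e' : Edge H} → src e ≡ src e' → tgt e ≡ tgt e' → e ≡ e'
  edge-≡ {edge s t p a} {edge .s .t q b} refl refl = cong (λ r → edge s t r a) (Finₚ.<-irrelevant p q)

  Vertex-≟ : (x y : Vertex) → Dec (x ≡ y)
  Vertex-≟ = Sumₚ.≡-dec Finₚ._≟_ (Productₚ.≡-dec edge-≟ Finₚ._≟_)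
    where
      edge-≟ : (e e' : Edge H) → Dec (e ≡ e')
      edge-≟ e e' with src e Finₚ.≟ src e' | tgt e Finₚ.≟ tgt e'
      ... | yes s≡ | yes t≡ = yes (edge-≡ s≡ t≡)
      ... | no s≢ | _ = no (s≢ ∘ cong src)
      ... | _ | no t≢ = no (t≢ ∘ cong tgt)

  -- pos e j : the j-th vertex (0 ≤ j ≤ k) of the path replacing the edge e.
  pos-after : Edge H → (j : ℕ) → Dec (j < k') → Vertex
  pos-after e j (yes j<k') = inj₂ (e , fromℕ< j<k')
  pos-after e j (no _) = inj₁ (tgt e)

  pos : Edge H → ℕ → Vertex
  pos e zero = inj₁ (src e)
  pos e (suc j) = pos-after e j (j <? k')

  onPath⇒pos : ∀ {e j x} → OnPath H k e j x → x ≡ pos e j × j ≤ k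
  onPath⇒pos start = refl , z≤n
  onPath⇒pos end with k' <? k'
  ... | yes k'<k' = ⊥-elim (<-irrefl refl k'<k')
  ... | no _ = refl , ≤-refl
  onPath⇒pos {e} (mid i) with toℕ i <? k'
  ... | yes i<k' = cong (λ t → inj₂ (e , t)) (sym (Finₚ.fromℕ<-toℕ i i<k')) , s≤s (<⇒≤ (Finₚ.toℕ<n i))
  ... | no i≮k' = ⊥-elim (i≮k' (Finₚ.toℕ<n i))

  pos⇒onPath : ∀ {e j} → j ≤ k → OnPath H k e j (pos e j)
  pos⇒onPath {e} {zero} _ = start
  pos⇒onPath {e} {suc j} (s≤s j≤k') with j <? k'
  ... | yes j<k' = subst (λ t → OnPath H k e (suc t) (inj₂ (e , fromℕ< j<k'))) (Finₚ.toℕ-fromℕ< j<k')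
                     (mid (fromℕ< j<k'))
  ... | no j≮k' with refl ← ≤-antisym j≤k' (≮⇒≥ j≮k') = end

  pos-k : ∀ e → pos e k ≡ inj₁ (tgt e)
  pos-k e = sym (proj₁ (onPath⇒pos {e} end))

  pos-internal : ∀ e i → pos e (suc (toℕ i)) ≡ inj₂ (e , i)
  pos-internal e i = sym (proj₁ (onPath⇒pos (mid i)))

  rank : Edge H → Vertex → ℕ
  rank e (inj₁ v) with v Finₚ.≟ src e
  ... | yes _ = 0
  ... | no _ = k
  rank e (inj₂ (_ , i)) = suc (toℕ i)

  rank-pos : ∀ e j → j ≤ k → rank e (pos e j) ≡ j
  rank-pos e zero _ with src e Finₚ.≟ src e
  ... | yes _ = refl
  ... | no s≢s = ⊥-elim (s≢s refl)
  rank-pos e (suc j) (s≤s j≤k') with j <? k'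
  ... | yes j<k' = cong suc (Finₚ.toℕ-fromℕ< j<k')
  ... | no j≮k' with tgt e Finₚ.≟ src e
  ...   | yes t≡s = ⊥-elim (Finₚ.<-irrefl (sym t≡s) (src<tgt e))
  ...   | no _ = cong suc (≤-antisym (≮⇒≥ j≮k') j≤k')

  pos-injective : ∀ {e j j'} → j ≤ k → j' ≤ k → pos e j ≡ pos e j' → j ≡ j'
  pos-injective {e} {j} {j'} j≤k j'≤k eq =
    trans (sym (rank-pos e j j≤k)) (trans (cong (rank e) eq) (rank-pos e j' j'≤k))

  pos-adjacent : ∀ {e j} → j < k → adj S (pos e j) (pos e (suc j))
  pos-adjacent {e} {j} j<k = e , j , inj₁ (pos⇒onPath (<⇒≤ j<k) , pos⇒onPath j<k)

  internal-neighbours : ∀ {e i y} → adj S (inj₂ (e , i)) y →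
    y ≡ pos e (toℕ i) ⊎ y ≡ pos e (suc (suc (toℕ i)))
  internal-neighbours (_ , _ , inj₁ (mid _ , q)) = inj₂ (proj₁ (onPath⇒pos q))
  internal-neighbours (_ , _ , inj₂ (q , mid _)) = inj₁ (proj₁ (onPath⇒pos q))

  pos-neighbours : ∀ {e j y} → suc j < k → adj S (pos e (suc j)) y →
    y ≡ pos e j ⊎ y ≡ pos e (suc (suc j))
  pos-neighbours {e} {j} (s≤s j<k') a with j <? k'
  ... | no j≮k' = ⊥-elim (j≮k' j<k')
  ... | yes lt = subst (λ t → _ ≡ pos e t ⊎ _ ≡ pos e (suc (suc t))) (Finₚ.toℕ-fromℕ< lt)
                      (internal-neighbours a)

  original-neighbours : ∀ {u y} → adj S (inj₁ u) y →
    Σ (Edge H) λ e → (src e ≡ u × y ≡ pos e 1) ⊎ (tgt e ≡ u × y ≡ pos e k')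
  original-neighbours (e , _ , inj₁ (start , q)) = e , inj₁ (refl , proj₁ (onPath⇒pos q))
  original-neighbours (e , _ , inj₁ (end , q)) = ⊥-elim (<-irrefl refl (proj₂ (onPath⇒pos q)))
  original-neighbours (e , _ , inj₂ (q , end)) = e , inj₂ (refl , proj₁ (onPath⇒pos q))

  -- The path of e traversed from src e (b = true) or from tgt e (b = false).
  dpos : Edge H → Bool → ℕ → Vertex
  dpos e true j = pos e j
  dpos e false j = pos e (k ∸ j)

  origin terminus : Edge H → Bool → Fin n
  origin e true = src e
  origin e false = tgt e
  terminus e true = tgt e
  terminus e false = src e

  dpos-from : ∀ e b {u} → origin e b ≡ u → dpos e b 0 ≡ inj₁ u
  dpos-from e true refl = refl
  dpos-from e false refl = pos-k e

  dpos-to : ∀ e b {v} → terminus e b ≡ v → dpos e b k ≡ inj₁ v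
  dpos-to e true refl = pos-k e
  dpos-to e false refl = cong (pos e) (n∸n≡0 k)

  dpos-adjacent : ∀ {e b j} → j < k → adj S (dpos e b j) (dpos e b (suc j))
  dpos-adjacent {e} {true} j<k = pos-adjacent j<k
  dpos-adjacent {e} {false} {j} j<k =
    e , k ∸ suc j , inj₂ (pos⇒onPath (m∸n≤m k (suc j)) ,
      subst (λ t → OnPath H k e t (pos e (k ∸ j))) (∸-suc j<k) (pos⇒onPath (m∸n≤m k j)))

  dpos-injective : ∀ {e b j j'} → j ≤ k → j' ≤ k → dpos e b j ≡ dpos e b j' → j ≡ j'
  dpos-injective {e} {true} j≤k j'≤k eq = pos-injective j≤k j'≤k eq
  dpos-injective {e} {false} {j} {j'} j≤k j'≤k eq =
    ∸-cancelˡ-≡ j≤k j'≤k (pos-injective (m∸n≤m k j) (m∸n≤m k j') eq)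

  dpos-neighbours : ∀ {e b j y} → suc j < k → adj S (dpos e b (suc j)) y →
    y ≡ dpos e b j ⊎ y ≡ dpos e b (suc (suc j))
  dpos-neighbours {e} {true} j<k a = pos-neighbours j<k a
  dpos-neighbours {e} {false} {j} {y} sj<k a
    with pos-neighbours {e} {k ∸ suc (suc j)} {y} inner (subst (λ t → adj S (pos e t) y) k-j-1 a)
    where
      k-j-1 : k ∸ suc j ≡ suc (k ∸ suc (suc j))
      k-j-1 = ∸-suc sj<k
      inner : suc (k ∸ suc (suc j)) < k
      inner = subst (_< k) k-j-1 (∸-monoʳ-< {k} {suc j} {0} z<s (<⇒≤ sj<k))
  ... | inj₁ y≡next = inj₂ y≡next
  ... | inj₂ y≡prev = inj₁ (trans y≡prev (cong (pos e) (sym k-j≡)))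
    where
      k-j≡ : k ∸ j ≡ suc (suc (k ∸ suc (suc j)))
      k-j≡ = trans (∸-suc (<-trans (n<1+n j) sj<k)) (cong suc (∸-suc sj<k))

  original-neighbour : ∀ {w y} → adj S (inj₁ w) y →
    Σ (Edge H) λ e → Σ Bool λ b → origin e b ≡ w × y ≡ dpos e b 1
  original-neighbour a with original-neighbours a
  ... | e , inj₁ (refl , y≡) = e , true , refl , y≡
  ... | e , inj₂ (refl , y≡) = e , false , refl , y≡

  -- When k ≥ 2 the second vertex of an oriented path is a subdivision vertex of its edge.
  dpos-second : Fin k' → ∀ e b → Σ (Fin k') λ i → dpos e b 1 ≡ inj₂ (e , i)
  dpos-second i e true = fromℕ< 1≤k' ,
    trans (cong (pos e ∘ suc) (sym (Finₚ.toℕ-fromℕ< 1≤k'))) (pos-internal e _)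
    where 1≤k' = ≤-trans (s≤s z≤n) (Finₚ.toℕ<n i)
  dpos-second i e false = fromℕ< k'-1<k' ,
    trans (cong (pos e) (trans (∸-suc 1≤k') (cong suc (sym (Finₚ.toℕ-fromℕ< k'-1<k'))))) (pos-internal e _)
    where
      1≤k' = ≤-trans (s≤s z≤n) (Finₚ.toℕ<n i)
      k'-1<k' : k' ∸ 1 < k'
      k'-1<k' = ∸-monoʳ-< {k'} {1} {0} z<s 1≤k'

  oriented-injective : ∀ {e b e' b'} → origin e b ≡ origin e' b' → terminus e b ≡ terminus e' b' →
    e ≡ e' × b ≡ b'
  oriented-injective {e} {true} {e'} {true} o t = edge-≡ o t , refl
  oriented-injective {e} {false} {e'} {false} o t = edge-≡ t o , refl
  oriented-injective {e} {true} {e'} {false} o t =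
    ⊥-elim (Finₚ.<-asym (src<tgt e) (subst₂ _<ᶠ_ (sym t) (sym o) (src<tgt e')))
  oriented-injective {e} {false} {e'} {true} o t =
    ⊥-elim (Finₚ.<-asym (src<tgt e) (subst₂ _<ᶠ_ (sym o) (sym t) (src<tgt e')))

  origin-injective : ∀ {e b b'} → origin e b ≡ origin e b' → b ≡ b'
  origin-injective {e} {true} {true} _ = refl
  origin-injective {e} {false} {false} _ = refl
  origin-injective {e} {true} {false} s≡t = ⊥-elim (Finₚ.<-irrefl s≡t (src<tgt e))
  origin-injective {e} {false} {true} t≡s = ⊥-elim (Finₚ.<-irrefl (sym t≡s) (src<tgt e))

  -- When k ≥ 2, two oriented paths from the same vertex with the same second
  -- vertex lie on the same edge, so they end at the same vertex.
  terminus-from-second : Fin k' → ∀ {e b e' b'} → origin e b ≡ origin e' b' →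
    dpos e b 1 ≡ dpos e' b' 1 → terminus e b ≡ terminus e' b'
  terminus-from-second i {e} {b} {e'} {b'} o eq
    with j , second ← dpos-second i e b | j' , second' ← dpos-second i e' b'
    with refl ← Productₚ.,-injectiveˡ (Sumₚ.inj₂-injective (trans (sym second) (trans eq second')))
    with refl ← origin-injective {e} {b} {b'} o = refl

  edge-of-adj : ∀ {u v} → adj H u v → Σ (Edge H) λ e → Σ Bool λ b → origin e b ≡ u × terminus e b ≡ v
  edge-of-adj {u} {v} a with Finₚ.<-cmp u v
  ... | tri< u<v _ _ = edge u v u<v a , true , refl , refl
  ... | tri≈ _ refl _ = ⊥-elim (proj₂ simple u a)
  ... | tri> _ _ v<u = edge v u v<u (proj₁ simple u v a) , false , refl , refl

  -- Conversely the ends of an oriented path are adjacent in H.  The adjacency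
  -- proof stored in an edge is irrelevant, so it is recovered through decidability.
  oriented-adjacent : (∀ x y → Dec (adj H x y)) → ∀ e b → adj H (origin e b) (terminus e b)
  oriented-adjacent dec e true = edge-adjacent e
    where
      edge-adjacent : ∀ e → adj H (src e) (tgt e)
      edge-adjacent (edge s t _ a) with dec s t
      ... | yes a′ = a′
      ... | no ¬a = Irrelevant.⊥-elim (¬a a)
  oriented-adjacent dec e false = proj₁ simple _ _ (oriented-adjacent dec e true)

  module Homomorphism (f : Vertex → Vertex) (f-adj : ∀ x y → adj S x y → adj S (f x) (f y))
                      (f-inj : ∀ {x y} → f x ≡ f y → x ≡ y) where

    -- If f maps the first two vertices of an oriented path onto the first two of
    -- another, it maps the whole path onto it: the image of the next vertex is a
    -- neighbour of the current image other than the previous one.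
    path-image : ∀ {e b e' b'} → f (dpos e b 0) ≡ dpos e' b' 0 → f (dpos e b 1) ≡ dpos e' b' 1 →
      ∀ j → suc j ≤ k → f (dpos e b j) ≡ dpos e' b' j × f (dpos e b (suc j)) ≡ dpos e' b' (suc j)
    path-image h₀ h₁ zero _ = h₀ , h₁
    path-image {e} {b} {e'} {b'} h₀ h₁ (suc j) sj<k
      with prev , current ← path-image {e} {b} {e'} {b'} h₀ h₁ j (<⇒≤ sj<k)
      with dpos-neighbours {e'} {b'} sj<k
             (subst (λ t → adj S t (f (dpos e b (suc (suc j))))) current (f-adj _ _ (dpos-adjacent {e} {b} sj<k)))
    ... | inj₂ next = current , next
    ... | inj₁ back = ⊥-elim (<⇒≢ (m<n+m j {2} z<s) (sym two-steps-back))
      where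
        two-steps-back : suc (suc j) ≡ j
        two-steps-back = dpos-injective {e} {b} sj<k (≤-trans (n≤1+n j) (<⇒≤ sj<k))
                           (f-inj (trans back (sym prev)))

    edge-path-image : ∀ {e b u w} → origin e b ≡ u → f (inj₁ u) ≡ inj₁ w →
      Σ (Edge H) λ e' → Σ Bool λ b' → ∀ j → j ≤ k → f (dpos e b j) ≡ dpos e' b' j
    edge-path-image {e} {b} o fu
      with e' , b' , o' , second ← original-neighbour
             (subst (λ t → adj S t (f (dpos e b 1))) (trans (cong f (dpos-from e b o)) fu)
                    (f-adj _ _ (dpos-adjacent {e} {b} z<s)))
      = e' , b' , image
      where
        first : f (dpos e b 0) ≡ dpos e' b' 0
        first = trans (cong f (dpos-from e b o)) (trans fu (sym (dpos-from e' b' o')))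
        image : ∀ j → j ≤ k → f (dpos e b j) ≡ dpos e' b' j
        image zero _ = first
        image (suc j) j<k = proj₂ (path-image {e} {b} {e'} {b'} first second j j<k)

    ends-image : ∀ {e b e' b' u v} → origin e b ≡ u → terminus e b ≡ v →
      (∀ j → j ≤ k → f (dpos e b j) ≡ dpos e' b' j) →
      f (inj₁ u) ≡ inj₁ (origin e' b') × f (inj₁ v) ≡ inj₁ (terminus e' b')
    ends-image {e} {b} {e'} {b'} o t image =
      trans (cong f (sym (dpos-from e b o))) (trans (image 0 z≤n) (dpos-from e' b' refl)) ,
      trans (cong f (sym (dpos-to e b t))) (trans (image k ≤-refl) (dpos-to e' b' refl))

    original-step : ∀ {u v} → adj H u v → IsOriginal (f (inj₁ u)) → IsOriginal (f (inj₁ v))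
    original-step a (w , fu)
      with e , b , o , t ← edge-of-adj a
      with e' , b' , image ← edge-path-image {e} {b} o fu
      = terminus e' b' , proj₂ (ends-image {e} {b} {e'} {b'} o t image)

    all-original : Connected H → ∀ {u₀} → IsOriginal (f (inj₁ u₀)) → ∀ u → IsOriginal (f (inj₁ u))
    all-original connected {u₀} o u = along (proj₂ (connected u₀ u)) o
      where
        along : ∀ {x y ℓ} → Walk H x y ℓ → IsOriginal (f (inj₁ x)) → IsOriginal (f (inj₁ y))
        along nil o = o
        along (cons a w) o = along w (original-step a o)

    -- A vertex with three distinct H-neighbours is not mapped to a subdivision
    -- vertex: those have only two neighbours, and the second vertices of the paths
    -- towards the three neighbours are distinct neighbours of u in S.
    not-to-internal : ∀ {u e i} → f (inj₁ u) ≡ inj₂ (e , i) → ¬ ThreeNeighbours H u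
    not-to-internal {u} {e} {i} fu (v₁ , v₂ , v₃ , (v₁≢v₂ , v₁≢v₃ , v₂≢v₃) , a₁ , a₂ , a₃)
      with e₁ , b₁ , o₁ , t₁ ← edge-of-adj a₁
      with e₂ , b₂ , o₂ , t₂ ← edge-of-adj a₂
      with e₃ , b₃ , o₃ , t₃ ← edge-of-adj a₃
      = [ v₁≢v₂ ∘ same-end e₁ b₁ e₂ b₂ o₁ t₁ o₂ t₂ ,
          [ v₁≢v₃ ∘ same-end e₁ b₁ e₃ b₃ o₁ t₁ o₃ t₃ , v₂≢v₃ ∘ same-end e₂ b₂ e₃ b₃ o₂ t₂ o₃ t₃ ]′ ]′
          (two-of-three (second-image e₁ b₁ o₁) (second-image e₂ b₂ o₂) (second-image e₃ b₃ o₃))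
      where
        second-image : ∀ e' b' → origin e' b' ≡ u →
          f (dpos e' b' 1) ≡ pos e (toℕ i) ⊎ f (dpos e' b' 1) ≡ pos e (suc (suc (toℕ i)))
        second-image e' b' o = internal-neighbours
          (subst (λ t → adj S t (f (dpos e' b' 1))) (trans (cong f (dpos-from e' b' o)) fu) (f-adj _ _ (dpos-adjacent {e'} {b'} z<s)))
        same-end : ∀ e b e' b' {v v'} → origin e b ≡ u → terminus e b ≡ v → origin e' b' ≡ u →
          terminus e' b' ≡ v' → f (dpos e b 1) ≡ f (dpos e' b' 1) → v ≡ v'
        same-end e b e' b' o t o' t' eq = trans (sym t) (trans (terminus-from-second i {e} {b} {e'} {b'} (trans o (sym o')) (f-inj eq)) t')

    branch-original : ∀ {u} → ThreeNeighbours H u → IsOriginal (f (inj₁ u))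
    branch-original {u} three with f (inj₁ u) in fu
    ... | inj₁ w = w , refl
    ... | inj₂ (e , i) = ⊥-elim (not-to-internal fu three)

    restrict-preserves : (∀ x y → Dec (adj H x y)) → (O : ∀ u → IsOriginal (f (inj₁ u))) →
      ∀ u v → adj H u v → adj H (proj₁ (O u)) (proj₁ (O v))
    restrict-preserves dec O u v a
      with e , b , o , t ← edge-of-adj a
      with e' , b' , image ← edge-path-image {e} {b} o (proj₂ (O u))
      with fu , fv ← ends-image {e} {b} {e'} {b'} o t image
      = subst₂ (adj H) (Sumₚ.inj₁-injective (trans (sym fu) (proj₂ (O u))))
                       (Sumₚ.inj₁-injective (trans (sym fv) (proj₂ (O v))))
                       (oriented-adjacent dec e' b')

    -- f is the identity as soon as it fixes every original vertex: it then maps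
    -- the path of each edge onto itself, in the same direction.
    identity-on-originals : (∀ u → f (inj₁ u) ≡ inj₁ u) → ∀ x → f x ≡ x
    identity-on-originals fixed (inj₁ u) = fixed u
    identity-on-originals fixed (inj₂ (e , i))
      with e' , b' , image ← edge-path-image {e} {true} refl (fixed (src e))
      with fs , ft ← ends-image {e} {true} {e'} {b'} refl refl image
      with refl , refl ← oriented-injective {e'} {b'} {e} {true}
                           (Sumₚ.inj₁-injective (trans (sym fs) (fixed (src e))))
                           (Sumₚ.inj₁-injective (trans (sym ft) (fixed (tgt e))))
      = begin
          f (inj₂ (e , i))          ≡⟨ cong f (sym (pos-internal e i)) ⟩
          f (pos e (suc (toℕ i)))   ≡⟨ image (suc (toℕ i)) (s≤s (<⇒≤ (Finₚ.toℕ<n i))) ⟩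
          pos e (suc (toℕ i))       ≡⟨ pos-internal e i ⟩
          inj₂ (e , i)              ∎
      where open ≡-Reasoning

  module Restriction (dec : ∀ x y → Dec (adj H x y)) (τ : Aut S)
                     (O : ∀ u → IsOriginal (⟦ τ ⟧ (inj₁ u))) (O⁻ : ∀ u → IsOriginal (⟦ τ ⟧⁻ (inj₁ u))) where
    private
      module T = Homomorphism ⟦ τ ⟧ (Aut.preserve τ) (⟦⟧-injective τ)
      module T⁻ = Homomorphism ⟦ τ ⟧⁻ (Aut.preserve (aut⁻¹ τ)) (⟦⟧-injective (aut⁻¹ τ))
      open ≡-Reasoning

    π π⁻ : Fin n → Fin n
    π u = proj₁ (O u)
    π⁻ u = proj₁ (O⁻ u)

    π-spec : ∀ u → ⟦ τ ⟧ (inj₁ u) ≡ inj₁ (π u)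
    π-spec u = proj₂ (O u)

    π⁻-π : ∀ u → π⁻ (π u) ≡ u
    π⁻-π u = Sumₚ.inj₁-injective (begin
      inj₁ (π⁻ (π u))           ≡⟨ sym (proj₂ (O⁻ (π u))) ⟩
      ⟦ τ ⟧⁻ (inj₁ (π u))       ≡⟨ cong ⟦ τ ⟧⁻ (sym (π-spec u)) ⟩
      ⟦ τ ⟧⁻ (⟦ τ ⟧ (inj₁ u))   ≡⟨ ⟦⟧⁻-⟦⟧ τ (inj₁ u) ⟩
      inj₁ u                    ∎)

    π-π⁻ : ∀ u → π (π⁻ u) ≡ u
    π-π⁻ u = Sumₚ.inj₁-injective (begin
      inj₁ (π (π⁻ u))           ≡⟨ sym (π-spec (π⁻ u)) ⟩
      ⟦ τ ⟧ (inj₁ (π⁻ u))       ≡⟨ cong ⟦ τ ⟧ (sym (proj₂ (O⁻ u))) ⟩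
      ⟦ τ ⟧ (⟦ τ ⟧⁻ (inj₁ u))   ≡⟨ ⟦⟧-⟦⟧⁻ τ (inj₁ u) ⟩
      inj₁ u                    ∎)

    restriction : Aut H
    restriction = record
      { perm = mk↔ₛ′ π π⁻ π-π⁻ π⁻-π
      ; preserve = T.restrict-preserves dec O
      ; reflect = λ x y a → subst₂ (adj H) (π⁻-π x) (π⁻-π y) (T⁻.restrict-preserves dec O⁻ (π x) (π y) a) }


module SubdividedPower {n' : ℕ} (G : Graph (Fin (suc (suc (suc n'))))) (simple : IsSimple G)
                       (connected : Connected G) (m : ℕ) (3≤m : 3 ≤ m) (k' : ℕ) where

  open ConnectedPower G simple connected m 3≤m
  open Subdivision H (power-simple m simple) k'

  extend : ∀ {d} → (Fin (suc (suc (suc n'))) → Fin d) → Vertex → Fin d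
  extend c (inj₁ v) = c v
  extend c (inj₂ _) = c fzero

  module _ {d : ℕ} (c : Fin (suc (suc (suc n'))) → Fin d) (distinguishing : IsDistinguishing H c) where

    -- An automorphism of S preserving the extended labeling maps original vertices
    -- to original vertices.  It suffices to find one such vertex (all-original).
    originals-preserved : (τ : Aut S) → (∀ x → extend c (⟦ τ ⟧ x) ≡ extend c x) →
      DoubleNegation (∀ u → IsOriginal (⟦ τ ⟧ (inj₁ u)))
    originals-preserved τ preserves = do
      u₀ , o ← one-original
      pure (T.all-original (power-connected (≤-trans (s≤s z≤n) 3≤m) simple connected) o)
      where
        module T = Homomorphism ⟦ τ ⟧ (Aut.preserve τ) (⟦⟧-injective τ)

        other-label-original : ∀ x → extend c x ≢ c fzero → IsOriginal x
        other-label-original (inj₁ w) _ = w , refl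
        other-label-original (inj₂ _) label≢ = ⊥-elim (label≢ refl)

        -- A vertex labeled differently from vertex 0 is mapped to an original vertex;
        -- if there is none, then n ≥ 4 (H = K₃ has no constant distinguishing
        -- labeling) and vertex 0 has three neighbours.
        one-original : DoubleNegation (Σ (Fin _) λ u → IsOriginal (⟦ τ ⟧ (inj₁ u)))
        one-original with Finₚ.any? (λ a → ¬? (c a Finₚ.≟ c fzero))
        ... | yes (a , ca≢c₀) = pure (a , other-label-original _ (ca≢c₀ ∘ trans (sym (preserves (inj₁ a)))))
        ... | no constant with 3 <? suc (suc (suc n'))
        ...   | yes 3<n = do
                  three ← three-neighbours 3<n fzero
                  pure (fzero , T.branch-original three)
        ...   | no 3≮n = do
                  complete ← complete-when-three (s≤s (≮⇒≥ 3≮n))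
                  ⊥-elim (complete-separates H (proj₂ (power-simple m simple)) complete c distinguishing
                            (sym (same-label (fsuc fzero))))
          where
            same-label : ∀ a → c a ≡ c fzero
            same-label a = decidable-stable (c a Finₚ.≟ c fzero) (λ ca≢c₀ → constant (a , ca≢c₀))

    -- The extended labeling is distinguishing: a label-preserving τ restricts to a
    -- label-preserving automorphism of H, which is the identity, hence so is τ.
    extend-distinguishing : IsDistinguishing S (extend c)
    extend-distinguishing τ preserves x =
      decidable-stable (Vertex-≟ (⟦ τ ⟧ x) x) (λ τx≢x → identity (λ τ≡id → τx≢x (τ≡id x)))
      where
        preserves⁻ : ∀ x → extend c (⟦ τ ⟧⁻ x) ≡ extend c x
        preserves⁻ x = trans (sym (preserves (⟦ τ ⟧⁻ x))) (cong (extend c) (⟦⟧-⟦⟧⁻ τ x))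

        identity-from : (∀ x y → Dec (adj H x y)) → (O : ∀ u → IsOriginal (⟦ τ ⟧ (inj₁ u))) →
          (O⁻ : ∀ u → IsOriginal (⟦ τ ⟧⁻ (inj₁ u))) → ∀ x → ⟦ τ ⟧ x ≡ x
        identity-from dec O O⁻ =
          Homomorphism.identity-on-originals ⟦ τ ⟧ (Aut.preserve τ) (⟦⟧-injective τ)
            (λ u → trans (π-spec u) (cong inj₁ (distinguishing restriction restriction-labels u)))
          where
            open Restriction dec τ O O⁻
            restriction-labels : ∀ u → c (π u) ≡ c u
            restriction-labels u = trans (cong (extend c) (sym (π-spec u))) (preserves (inj₁ u))

        identity : DoubleNegation (∀ x → ⟦ τ ⟧ x ≡ x)
        identity = do
          dec ← ¬¬-decidable (adj H)
          O ← originals-preserved τ preserves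
          O⁻ ← originals-preserved (aut⁻¹ τ) preserves⁻
          pure (identity-from dec O O⁻)


corollary4p5 : (n : ℕ) (G : Graph (Fin n)) → IsSimple G → Connected G → 3 ≤ n →
    (m k : ℕ) → 3 ≤ m → 1 ≤ k →
    (∀ d₁ d₂ → IsDistNum (Subdiv G k) d₁ → IsDistNum (Power (Subdiv G k) m) d₂ → d₁ ≤ d₂)
    × (∀ d₁ d₂ → IsDistNum (Subdiv (Power G m) k) d₁ → IsDistNum (Power G m) d₂ → d₁ ≤ d₂)
corollary4p5 (suc (suc (suc n'))) G simple connected (s≤s (s≤s (s≤s z≤n))) m (suc k') 3≤m (s≤s z≤n) =
  distNum-≤-power (Subdiv G (suc k')) m ,
  distNum-≤ λ _ (c , distinguishing) → extend c , extend-distinguishing c distinguishing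
  where open SubdividedPower G simple connected m 3≤m k'
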